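{- Let $G$ be a symmetric even graph with vertex set $V$, and let $\mathcal{DB}(G)$ be the class of subsets of $V$ that are both dominating sets and boundary sets. Then (i) for every nonempty $S\subseteq V$, $S\in\mathcal{DB}(G)$ if and only if $C_S(G)\in\mathcal{DB}(G)$; and (ii) for $S_1,S_2\in\mathcal{DB}(G)$, $C_{S_1}(G)=S_2$ if and only if $C_{S_2}(G)=S_1$.
   Context: $G$ is finite, simple, connected; $d$ is shortest-path distance and $\mathrm{diam}(G)=\max_{u,v}d(u,v)$. $G$ is even if for each vertex $u$ there is a unique vertex $\bar u$ with $d(u,\bar u)=\mathrm{diam}(G)$; an even graph is symmetric if $d(u,v)+d(u,\bar v)=\mathrm{diam}(G)$ for all $u,v\in V$. $N(x)$ is the set of neighbours of $x$. $S$ is dominating if every vertex of $V\setminus S$ is adjacent to a vertex of $S$. A vertex $x\in S$ is an interior vertex of $S$ if $N(x)\subseteq S$; $S$ is a boundary set if it contains no interior vertex. For nonempty $S\subseteq V$, $e_S(v)=\max_{x\in S}d(v,x)$ and $C_S(G)=\{v\in V: e_S(v)\le e_S(x)\ \forall x\in V\}$. -}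

module Defs where

open import Data.Nat using (ℕ; zero; suc; _⊔_; _≤ᵇ_; _+_; _<_)
open import Data.Bool using (Bool; true; false; _∨_; _∧_; if_then_else_; T)
open import Data.Fin using (Fin; _≟_)
open import Data.Fin.Subset using (Subset; _∈_; _∉_; Nonempty)
open import Data.List using (List; foldr; map; allFin)
open import Data.Bool.ListAction using (any; all)
open import Data.Vec using (lookup; tabulate)
open import Data.Product using (Σ; ∃; _×_; _,_; proj₁)
open import Relation.Nullary using (¬_)
open import Relation.Nullary.Decidable using (isYes)
open import Relation.Binary.PropositionalEquality using (_≡_)

record Graph (n : ℕ) : Set where
  field
    adj    : Fin n → Fin n → Bool
    sym    : ∀ u v → adj u v ≡ adj v u
    irrefl : ∀ u → adj u u ≡ false
open Graph public

module _ {n : ℕ} (G : Graph n) where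

  data Walk : Fin n → Fin n → ℕ → Set where
    here : ∀ {u} → Walk u u 0
    step : ∀ {u w v k} → T (adj G u w) → Walk w v k → Walk u v (suc k)

  Connected : Set
  Connected = ∀ u v → ∃ λ k → Walk u v k

  within : ℕ → Fin n → Fin n → Bool
  within zero    u v = isYes (u ≟ v)
  within (suc k) u v = within k u v ∨ any (λ w → within k u w ∧ adj G w v) (allFin n)

  -- least b p : the least k < b with p k = true (b if none).
  least : ℕ → (ℕ → Bool) → ℕ
  least zero    p = zero
  least (suc b) p = if p zero then zero else suc (least b (λ k → p (suc k)))

  -- shortest-path distance (for connected G the least k occurs below n)
  dist : Fin n → Fin n → ℕ
  dist u v = least n (λ k → within k u v)

  maxList : List ℕ → ℕ
  maxList = foldr _⊔_ 0

  diam : ℕ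
  diam = maxList (map (λ u → maxList (map (dist u) (allFin n))) (allFin n))

  Even : Set
  Even = ∀ u → Σ (Fin n) λ ū → dist u ū ≡ diam × (∀ w → dist u w ≡ diam → w ≡ ū)

  antipode : Even → Fin n → Fin n
  antipode ev u = proj₁ (ev u)

  SymmetricEven : Set
  SymmetricEven = Σ Even λ ev → ∀ u v → dist u v + dist u (antipode ev v) ≡ diam

  Dominating : Subset n → Set
  Dominating S = ∀ v → v ∉ S → Σ (Fin n) λ x → x ∈ S × T (adj G v x)

  Interior : Subset n → Fin n → Set
  Interior S x = x ∈ S × (∀ y → T (adj G x y) → y ∈ S)

  Boundary : Subset n → Set
  Boundary S = ∀ x → ¬ Interior S x

  DB : Subset n → Set
  DB S = Dominating S × Boundary S

  ecc : Subset n → Fin n → ℕ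
  ecc S v = maxList (map (λ x → if lookup S x then dist v x else 0) (allFin n))

  center : Subset n → Subset n
  center S = tabulate (λ v → all (λ x → ecc S v ≤ᵇ ecc S x) (allFin n))

-- The antipodal map a is an involutive isometry of G, and symmetry says
-- d(v, x) + d(a v, x) = diam, so e_S(v) = diam − d(a v, S). For a nonempty
-- dominating S this gives e_S ≥ diam − 1 everywhere, with equality exactly when
-- a v ∉ S as long as some vertex lies outside S (as it does for a boundary set).
-- Hence C_S = a(V ∖ S) for S ∈ DB; complementation swaps the dominating and
-- boundary conditions and a is an automorphism, so C_S ∈ DB, and (ii) follows
-- since a is an involution. Conversely, if C_S ∈ DB: a vertex y at distance ≥ 2
-- from S would give e_S(a y) ≤ diam − 2 < e_S(v) for a centre vertex v with a v
-- near S; an interior vertex of S would give a centre vertex with e_S = diam,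
-- forcing C_S = V, which has interior vertices.
module Submission where

open import Defs
open import Data.Nat using (ℕ; _<_)
open import Data.Fin.Subset using (Subset; Nonempty)
open import Data.Product using (_×_)
open import Function.Bundles using (_⇔_)
open import Relation.Binary.PropositionalEquality using (_≡_)

open import Data.Bool using (Bool; true; false; T; if_then_else_)
open import Data.Bool.Properties using (T-∨; T-∧; T-≡)
open import Data.Empty using (⊥-elim)
open import Data.Fin using (Fin; toℕ; fromℕ<)
open import Data.Fin.Properties using (any?; toℕ-injective; toℕ<n)
open import Data.Fin.Subset using (_∈_; _∉_; _⊆_)
open import Data.Fin.Subset.Properties using (_∈?_; ⊆-antisym)
open import Data.List using (List; []; _∷_; map; allFin; foldr)
open import Data.List.Membership.Propositional using (lose) renaming (_∈_ to _∈ₗ_)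
open import Data.List.Membership.Propositional.Properties using (∈-allFin)
open import Data.Bool.ListAction using (all)
open import Data.List.Relation.Unary.All as All using ()
open import Data.List.Relation.Unary.All.Properties using (all⁺; all⁻)
open import Data.List.Relation.Unary.Any using (here; there; satisfied)
open import Data.List.Relation.Unary.Any.Properties using (any⁺; any⁻)
open import Data.Nat using (zero; suc; _+_; _≤_; _⊔_; _≤ᵇ_; z≤n; s≤s; s≤s⁻¹)
open import Data.Nat.Properties
open import Data.Product using (∃; _,_; proj₁; proj₂)
open import Data.Sum using (_⊎_; inj₁; inj₂)
open import Data.Vec using (lookup)
open import Data.Vec.Properties using (lookup∘tabulate; []=⇒lookup; lookup⇒[]=)
open import Function.Bundles using (mk⇔; Equivalence)
open import Relation.Nullary using (¬_; yes; no)
open import Relation.Nullary.Decidable using (toWitness; fromWitness; ¬?; T?; _×-dec_; decidable-stable)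
open import Relation.Binary.PropositionalEquality using (refl; trans; cong; cong₂; subst; _≢_; module ≡-Reasoning)
import Relation.Binary.PropositionalEquality as ≡

maxList-upper : ∀ {A : Set} (f : A → ℕ) (xs : List A) {x} → x ∈ₗ xs → f x ≤ foldr _⊔_ 0 (map f xs)
maxList-upper f (y ∷ xs) (here refl) = m≤m⊔n (f y) _
maxList-upper f (y ∷ xs) (there x∈xs) = ≤-trans (maxList-upper f xs x∈xs) (m≤n⊔m (f y) _)

+-maxList-least : ∀ {A : Set} (f : A → ℕ) (xs : List A) c {m} → c ≤ m → (∀ x → c + f x ≤ m) →
                  c + foldr _⊔_ 0 (map f xs) ≤ m
+-maxList-least f []       c c≤m _ = subst (_≤ _) (≡.sym (+-identityʳ c)) c≤m
+-maxList-least f (y ∷ xs) c c≤m bound =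
  subst (_≤ _) (≡.sym (+-distribˡ-⊔ c (f y) _)) (⊔-lub (bound y) (+-maxList-least f xs c c≤m bound))

module _ {n : ℕ} (G : Graph n) where

  least-≤ : ∀ b (p : ℕ → Bool) k → T (p k) → least G b p ≤ k
  least-≤ zero    p k       _ = z≤n
  least-≤ (suc b) p k       t with p zero in eq
  ... | true = z≤n
  least-≤ (suc b) p zero    t | false = ⊥-elim (subst T eq t)
  least-≤ (suc b) p (suc k) t | false = s≤s (least-≤ b (λ j → p (suc j)) k t)

  least-satisfies : ∀ b (p : ℕ → Bool) → least G b p < b → T (p (least G b p))
  least-satisfies (suc b) p lt with p zero in eq
  ... | true  = subst T (≡.sym eq) _
  ... | false = least-satisfies b (λ j → p (suc j)) (s≤s⁻¹ lt)

  least-≤-bound : ∀ b (p : ℕ → Bool) → least G b p ≤ b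
  least-≤-bound zero    p = z≤n
  least-≤-bound (suc b) p with p zero
  ... | true  = z≤n
  ... | false = s≤s (least-≤-bound b (λ j → p (suc j)))

  record Adjacent (u v : Fin n) : Set where
    constructor adjacent
    field edge : T (adj G u v)

  Adjacent-sym : ∀ {u v} → Adjacent u v → Adjacent v u
  Adjacent-sym {u} {v} (adjacent e) = adjacent (subst T (Graph.sym G u v) e)

  Adjacent-irrefl : ∀ {u} → ¬ Adjacent u u
  Adjacent-irrefl {u} (adjacent e) = subst T (irrefl G u) e

  record Within (k : ℕ) (u v : Fin n) : Set where
    constructor within-path
    field reach : T (within G k u v)
  open Within

  within-refl : ∀ {u} → Within 0 u u
  within-refl = within-path (fromWitness refl)

  within-zero : ∀ {u v} → Within 0 u v → u ≡ v
  within-zero (within-path r) = toWitness r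

  within-suc : ∀ {k u v} → Within k u v → Within (suc k) u v
  within-suc (within-path r) = within-path (Equivalence.from T-∨ (inj₁ r))

  within-snoc : ∀ {k u w v} → Within k u w → Adjacent w v → Within (suc k) u v
  within-snoc {k} {u} {w} {v} (within-path r) (adjacent e) =
    within-path (Equivalence.from (T-∨ {within G k u v}) (inj₂ (any⁺ _ (lose (∈-allFin w) (Equivalence.from T-∧ (r , e))))))

  within-unsnoc : ∀ {k u v} → Within (suc k) u v → Within k u v ⊎ ∃ λ w → Within k u w × Adjacent w v
  within-unsnoc {k} {u} {v} (within-path r) with Equivalence.to (T-∨ {within G k u v}) r
  ... | inj₁ r′ = inj₁ (within-path r′)
  ... | inj₂ r′ with satisfied (any⁻ _ (allFin n) r′)
  ... | w , rw = let r″ , e = Equivalence.to (T-∧ {within G k u w}) rw in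
                 inj₂ (w , within-path r″ , adjacent e)

  within-cons : ∀ {k u w v} → Adjacent u w → Within k w v → Within (suc k) u v
  within-cons {zero} e r with within-zero r
  ... | refl = within-snoc within-refl e
  within-cons {suc k} e r with within-unsnoc r
  ... | inj₁ r′           = within-suc (within-cons e r′)
  ... | inj₂ (w , r′ , e′) = within-snoc (within-cons e r′) e′

  within-sym : ∀ {k u v} → Within k u v → Within k v u
  within-sym {zero} r with within-zero r
  ... | refl = within-refl
  within-sym {suc k} r with within-unsnoc r
  ... | inj₁ r′           = within-suc (within-sym r′)
  ... | inj₂ (w , r′ , e) = within-cons (Adjacent-sym e) (within-sym r′)

  within-mono : ∀ {j k u v} → j ≤ k → Within j u v → Within k u v
  within-mono j≤k r with m≤n⇒m<n∨m≡n j≤k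
  ... | inj₂ refl      = r
  ... | inj₁ (s≤s j≤k′) = within-suc (within-mono j≤k′ r)

  within-one : ∀ {u v} → Within 1 u v → u ≡ v ⊎ Adjacent u v
  within-one r with within-unsnoc r
  ... | inj₁ r′           = inj₁ (within-zero r′)
  ... | inj₂ (w , r′ , e) with within-zero r′
  ... | refl = inj₂ e

  d : Fin n → Fin n → ℕ
  d = dist G

  dist-≤ : ∀ {k u v} → Within k u v → d u v ≤ k
  dist-≤ {k} {u} {v} r = least-≤ n (λ j → within G j u v) k (reach r)

  dist-within : ∀ u v → d u v < n → Within (d u v) u v
  dist-within u v lt = within-path (least-satisfies n (λ k → within G k u v) lt)

  dist≤n : ∀ u v → d u v ≤ n
  dist≤n u v = least-≤-bound n (λ k → within G k u v)

  dist-sym-≤ : ∀ u v → d u v ≤ d v u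
  dist-sym-≤ u v with d v u <? n
  ... | yes lt = dist-≤ (within-sym (dist-within v u lt))
  ... | no  ge = ≤-trans (dist≤n u v) (≮⇒≥ ge)

  dist-sym : ∀ u v → d u v ≡ d v u
  dist-sym u v = ≤-antisym (dist-sym-≤ u v) (dist-sym-≤ v u)

  dist-refl : ∀ u → d u u ≡ 0
  dist-refl u = n≤0⇒n≡0 (dist-≤ within-refl)

  dist≡0⇒≡ : ∀ {u v} → d u v ≡ 0 → u ≡ v
  dist≡0⇒≡ {u} {v} d≡0 = within-zero (subst (λ k → Within k u v) d≡0 (dist-within u v d<n))
    where
    d<n : d u v < n
    d<n = subst (_< n) (≡.sym d≡0) (≤-<-trans z≤n (toℕ<n u))

  Adjacent⇒dist≤1 : ∀ {u v} → Adjacent u v → d u v ≤ 1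
  Adjacent⇒dist≤1 e = dist-≤ (within-snoc within-refl e)

  dist≤1⇒≡⊎Adjacent : ∀ {u v} → d u v ≤ 1 → u ≡ v ⊎ Adjacent u v
  dist≤1⇒≡⊎Adjacent {u} {v} d≤1 with d u v <? n
  ... | yes lt = within-one (within-mono d≤1 (dist-within u v lt))
  -- Unreachable pairs get the junk distance n, so here n ≤ 1.
  ... | no  ge = inj₁ (toℕ-injective (trans (toℕ≡0 u) (≡.sym (toℕ≡0 v))))
    where
    toℕ≡0 : ∀ w → toℕ w ≡ 0
    toℕ≡0 w = n≤0⇒n≡0 (s≤s⁻¹ (≤-trans (toℕ<n w) (≤-trans (≮⇒≥ ge) d≤1)))

  module _ (S : Subset n) where

    dist≤ecc : ∀ {v x} → x ∈ S → d v x ≤ ecc G S v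
    dist≤ecc {v} {x} x∈S =
      subst (λ b → (if b then d v x else 0) ≤ ecc G S v) ([]=⇒lookup x∈S) (maxList-upper _ (allFin n) (∈-allFin x))

    +-ecc-least : ∀ {v} c {m} → c ≤ m → (∀ x → x ∈ S → c + d v x ≤ m) → c + ecc G S v ≤ m
    +-ecc-least {v} c {m} c≤m bound = +-maxList-least _ (allFin n) c c≤m bound′
      where
      bound′ : ∀ x → c + (if lookup S x then d v x else 0) ≤ m
      bound′ x with lookup S x in eq
      ... | true  = bound x (lookup⇒[]= x S eq)
      ... | false = subst (_≤ m) (≡.sym (+-identityʳ c)) c≤m

    ∈center⇒ecc≤ : ∀ {v} → v ∈ center G S → ∀ x → ecc G S v ≤ ecc G S x
    ∈center⇒ecc≤ {v} v∈C x = ≤ᵇ⇒≤ _ _ (All.lookup (all⁺ _ (allFin n) central) (∈-allFin x))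
      where
      central : T (all (λ x → ecc G S v ≤ᵇ ecc G S x) (allFin n))
      central = Equivalence.from T-≡ (trans (≡.sym (lookup∘tabulate _ v)) ([]=⇒lookup v∈C))

    ecc≤⇒∈center : ∀ {v} → (∀ x → ecc G S v ≤ ecc G S x) → v ∈ center G S
    ecc≤⇒∈center {v} minimal = lookup⇒[]= v (center G S)
      (trans (lookup∘tabulate _ v) (Equivalence.to T-≡ (all⁻ _ {allFin n} (All.tabulate (λ {x} _ → ≤⇒≤ᵇ (minimal x))))))

    dominating⇒close : Dominating G S → ∀ u → ∃ λ x → x ∈ S × d u x ≤ 1
    dominating⇒close dom u with u ∈? S
    ... | yes u∈S = u , u∈S , ≤-trans (≤-reflexive (dist-refl u)) z≤n
    ... | no  u∉S = let x , x∈S , e = dom u u∉S in x , x∈S , Adjacent⇒dist≤1 (adjacent e)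

    ¬Interior⇒exit : ∀ {x} → x ∈ S → ¬ Interior G S x → ∃ λ y → Adjacent x y × y ∉ S
    ¬Interior⇒exit {x} x∈S ¬int with any? (λ y → T? (adj G x y) ×-dec ¬? (y ∈? S))
    ... | yes (y , e , y∉S) = y , adjacent e , y∉S
    ... | no  ∄exit = ⊥-elim (¬int (x∈S , λ y e → decidable-stable (y ∈? S) (λ y∉S → ∄exit (y , e , y∉S))))

    boundary⇒outside : Nonempty S → Boundary G S → ∃ λ u → u ∉ S
    boundary⇒outside (x , x∈S) bnd = let y , _ , y∉S = ¬Interior⇒exit x∈S (bnd x) in y , y∉S

    dominating⇒nonempty : 0 < n → Dominating G S → Nonempty S
    dominating⇒nonempty 0<n dom with fromℕ< 0<n ∈? S
    ... | yes u∈S = _ , u∈S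
    ... | no  u∉S = let x , x∈S , _ = dom (fromℕ< 0<n) u∉S in x , x∈S

  module Antipodal (se : SymmetricEven G) where

    D : ℕ
    D = diam G

    a : Fin n → Fin n
    a = antipode G (proj₁ se)

    dist-antipode : ∀ u → d u (a u) ≡ D
    dist-antipode u = proj₁ (proj₂ (proj₁ se u))

    dist≡diam⇒antipode : ∀ u w → d u w ≡ D → w ≡ a u
    dist≡diam⇒antipode u = proj₂ (proj₂ (proj₁ se u))

    dist+dist-antipode : ∀ u v → d u v + d u (a v) ≡ D
    dist+dist-antipode = proj₂ se

    dist≤diam : ∀ u v → d u v ≤ D
    dist≤diam u v = subst (d u v ≤_) (dist+dist-antipode u v) (m≤m+n _ _)

    dist<diam : ∀ u v → v ≢ a u → d u v < D
    dist<diam u v v≢au = ≤∧≢⇒< (dist≤diam u v) (λ e → v≢au (dist≡diam⇒antipode u v e))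

    antipode-involutive : ∀ u → a (a u) ≡ u
    antipode-involutive u = ≡.sym (dist≡0⇒≡ (+-cancelˡ-≡ D _ 0 (begin
      D + d u (a (a u))         ≡⟨ cong (_+ d u (a (a u))) (dist-antipode u) ⟨
      d u (a u) + d u (a (a u)) ≡⟨ dist+dist-antipode u (a u) ⟩
      D                         ≡⟨ +-identityʳ D ⟨
      D + 0                     ∎)))
      where open ≡-Reasoning

    antipode-isometry : ∀ u w → d (a u) (a w) ≡ d u w
    antipode-isometry u w = +-cancelˡ-≡ (d (a u) w) _ _ (begin
      d (a u) w + d (a u) (a w) ≡⟨ dist+dist-antipode (a u) w ⟩
      D                         ≡⟨ dist+dist-antipode w u ⟨
      d w u + d w (a u)         ≡⟨ cong₂ _+_ (dist-sym w u) (dist-sym w (a u)) ⟩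
      d u w + d (a u) w         ≡⟨ +-comm (d u w) _ ⟩
      d (a u) w + d u w         ∎)
      where open ≡-Reasoning

    antipode-adjacent : ∀ {u w} → Adjacent u w → Adjacent (a u) (a w)
    antipode-adjacent {u} {w} e with dist≤1⇒≡⊎Adjacent (subst (_≤ 1) (≡.sym (antipode-isometry u w)) (Adjacent⇒dist≤1 e))
    ... | inj₂ e′ = e′
    ... | inj₁ au≡aw = ⊥-elim (Adjacent-irrefl (subst (Adjacent u) (≡.sym u≡w) e))
      where
      u≡w : u ≡ w
      u≡w = trans (≡.sym (antipode-involutive u)) (trans (cong a au≡aw) (antipode-involutive w))

    dist-antipodeʳ : ∀ v x → d v (a x) ≡ d (a v) x
    dist-antipodeʳ v x = trans (≡.sym (antipode-isometry v (a x))) (cong (d (a v)) (antipode-involutive x))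

    dist+dist-antipodeˡ : ∀ v x → d v x + d (a v) x ≡ D
    dist+dist-antipodeˡ v x = subst (λ k → d v x + k ≡ D) (dist-antipodeʳ v x) (dist+dist-antipode v x)

    antipode-adjacentˡ : ∀ {u w} → Adjacent (a u) w → Adjacent u (a w)
    antipode-adjacentˡ {u} {w} e = subst (λ z → Adjacent z (a w)) (antipode-involutive u) (antipode-adjacent e)

    dominating⇒antipode-close : ∀ {X} → Dominating G X → ∀ x → ∃ λ v → v ∈ X × d (a v) x ≤ 1
    dominating⇒antipode-close {X} dom x =
      let v , v∈X , close = dominating⇒close X dom (a x) in
      v , v∈X , subst (_≤ 1) (trans (dist-sym (a x) v) (dist-antipodeʳ v x)) close

    module _ (S : Subset n) where

      ecc≤diam : ∀ v → ecc G S v ≤ D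
      ecc≤diam v = +-ecc-least S 0 z≤n (λ x _ → dist≤diam v x)

      antipode∈⇒ecc≡diam : ∀ {v} → a v ∈ S → ecc G S v ≡ D
      antipode∈⇒ecc≡diam {v} av∈S =
        ≤-antisym (ecc≤diam v) (subst (_≤ ecc G S v) (dist-antipode v) (dist≤ecc S av∈S))

      antipode∉⇒ecc<diam : Nonempty S → ∀ {v} → a v ∉ S → ecc G S v < D
      antipode∉⇒ecc<diam (x₀ , x₀∈S) {v} av∉S =
        +-ecc-least S 1 (≤-<-trans z≤n (dist<diam v x₀ (not-antipode x₀∈S))) (λ x x∈S → dist<diam v x (not-antipode x∈S))
        where
        not-antipode : ∀ {x} → x ∈ S → x ≢ a v
        not-antipode x∈S refl = av∉S x∈S

      antipode-close⇒diam≤suc-ecc : ∀ {v x} → x ∈ S → d (a v) x ≤ 1 → D ≤ suc (ecc G S v)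
      antipode-close⇒diam≤suc-ecc {v} {x} x∈S close = begin
        D                   ≡⟨ dist+dist-antipodeˡ v x ⟨
        d v x + d (a v) x   ≤⟨ +-mono-≤ (dist≤ecc S x∈S) close ⟩
        ecc G S v + 1       ≡⟨ +-comm _ 1 ⟩
        suc (ecc G S v)     ∎
        where open ≤-Reasoning

      antipode-far⇒2+ecc≤diam : Nonempty S → ∀ {v} → (∀ x → x ∈ S → 2 ≤ d (a v) x) → 2 + ecc G S v ≤ D
      antipode-far⇒2+ecc≤diam (x₀ , x₀∈S) {v} far = +-ecc-least S 2 (≤-trans (m≤m+n 2 _) (bound x₀ x₀∈S)) bound
        where
        open ≤-Reasoning
        bound : ∀ x → x ∈ S → 2 + d v x ≤ D
        bound x x∈S = begin
          2 + d v x           ≤⟨ +-monoˡ-≤ (d v x) (far x x∈S) ⟩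
          d (a v) x + d v x   ≡⟨ +-comm (d (a v) x) _ ⟩
          d v x + d (a v) x   ≡⟨ dist+dist-antipodeˡ v x ⟩
          D                   ∎

      dominating⇒diam≤suc-ecc : Dominating G S → ∀ v → D ≤ suc (ecc G S v)
      dominating⇒diam≤suc-ecc dom v =
        let x , x∈S , close = dominating⇒close S dom (a v) in antipode-close⇒diam≤suc-ecc x∈S close

      ∈center⇒antipode∉ : Nonempty S → (∃ λ u → u ∉ S) → ∀ {v} → v ∈ center G S → a v ∉ S
      ∈center⇒antipode∉ nonempty (u , u∉S) {v} v∈C av∈S = <⇒≱ ecc-aau<D (begin
        D                   ≡⟨ antipode∈⇒ecc≡diam av∈S ⟨
        ecc G S v           ≤⟨ ∈center⇒ecc≤ S v∈C (a u) ⟩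
        ecc G S (a u)       ∎)
        where
        open ≤-Reasoning
        ecc-aau<D : ecc G S (a u) < D
        ecc-aau<D = antipode∉⇒ecc<diam nonempty (subst (_∉ S) (≡.sym (antipode-involutive u)) u∉S)

      antipode∉⇒∈center : Nonempty S → Dominating G S → ∀ {v} → a v ∉ S → v ∈ center G S
      antipode∉⇒∈center nonempty dom av∉S = ecc≤⇒∈center S λ x →
        s≤s⁻¹ (≤-trans (antipode∉⇒ecc<diam nonempty av∉S) (dominating⇒diam≤suc-ecc dom x))

      antipode∈center⇒center-full : ∀ {v} → v ∈ center G S → a v ∈ S → ∀ w → w ∈ center G S
      antipode∈center⇒center-full {v} v∈C av∈S w = ecc≤⇒∈center S λ x → begin
        ecc G S w   ≤⟨ ecc≤diam w ⟩
        D           ≡⟨ antipode∈⇒ecc≡diam av∈S ⟨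
        ecc G S v   ≤⟨ ∈center⇒ecc≤ S v∈C x ⟩
        ecc G S x   ∎
        where open ≤-Reasoning

      DB⇒center-DB : Nonempty S → DB G S → DB G (center G S)
      DB⇒center-DB nonempty (dom , bnd) = dom′ , bnd′
        where
        C = center G S
        outside = boundary⇒outside S nonempty bnd

        ∉center⇒antipode∈ : ∀ {v} → v ∉ C → a v ∈ S
        ∉center⇒antipode∈ {v} v∉C = decidable-stable (a v ∈? S) (λ av∉S → v∉C (antipode∉⇒∈center nonempty dom av∉S))

        ∉⇒antipode∈center : ∀ {y} → y ∉ S → a y ∈ C
        ∉⇒antipode∈center y∉S = antipode∉⇒∈center nonempty dom (subst (_∉ S) (≡.sym (antipode-involutive _)) y∉S)

        dom′ : Dominating G C
        dom′ v v∉C = let y , e , y∉S = ¬Interior⇒exit S (∉center⇒antipode∈ v∉C) (bnd (a v)) in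
          a y , ∉⇒antipode∈center y∉S , Adjacent.edge (antipode-adjacentˡ e)

        bnd′ : Boundary G C
        bnd′ x (x∈C , neighbours∈C) =
          let y , y∈S , e = dom (a x) (∈center⇒antipode∉ nonempty outside x∈C)
              ay∈C = neighbours∈C (a y) (Adjacent.edge (antipode-adjacentˡ (adjacent e)))
          in ∈center⇒antipode∉ nonempty outside ay∈C (subst (_∈ S) (≡.sym (antipode-involutive y)) y∈S)

      center-DB⇒DB : Nonempty S → DB G (center G S) → DB G S
      center-DB⇒DB nonempty@(x₀ , x₀∈S) (domC , bndC) = dom′ , bnd′
        where
        dom′ : Dominating G S
        dom′ y y∉S with any? (λ x → (x ∈? S) ×-dec T? (adj G y x))
        ... | yes found = found
        ... | no  ∄neighbour with dominating⇒antipode-close domC x₀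
        ... | v , v∈C , close = ⊥-elim (1+n≰n (begin
          2 + ecc G S (a y)     ≤⟨ antipode-far⇒2+ecc≤diam nonempty far ⟩
          D                     ≤⟨ antipode-close⇒diam≤suc-ecc x₀∈S close ⟩
          suc (ecc G S v)       ≤⟨ s≤s (∈center⇒ecc≤ S v∈C (a y)) ⟩
          suc (ecc G S (a y))   ∎))
          where
          open ≤-Reasoning
          far : ∀ x → x ∈ S → 2 ≤ d (a (a y)) x
          far x x∈S with d y x ≤? 1
          ... | no  d≰1 = subst (λ z → 2 ≤ d z x) (≡.sym (antipode-involutive y)) (≰⇒> d≰1)
          ... | yes d≤1 with dist≤1⇒≡⊎Adjacent d≤1
          ... | inj₁ refl = ⊥-elim (y∉S x∈S)
          ... | inj₂ e    = ⊥-elim (∄neighbour (x , x∈S , Adjacent.edge e))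

        bnd′ : Boundary G S
        bnd′ x (x∈S , neighbours∈S) with dominating⇒antipode-close domC x
        ... | v , v∈C , close = bndC x (full x , λ y _ → full y)
          where
          av∈S : a v ∈ S
          av∈S with dist≤1⇒≡⊎Adjacent close
          ... | inj₁ av≡x = subst (_∈ S) (≡.sym av≡x) x∈S
          ... | inj₂ e    = neighbours∈S (a v) (Adjacent.edge (Adjacent-sym e))
          full : ∀ w → w ∈ center G S
          full = antipode∈center⇒center-full v∈C av∈S

      DB⇒∈center⇔antipode∉ : 0 < n → DB G S → ∀ v → v ∈ center G S ⇔ a v ∉ S
      DB⇒∈center⇔antipode∉ 0<n (dom , bnd) _ = mk⇔
        (∈center⇒antipode∉ nonempty (boundary⇒outside S nonempty bnd))
        (antipode∉⇒∈center nonempty dom)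
        where
        nonempty = dominating⇒nonempty S 0<n dom

    center-swap : 0 < n → ∀ {S₁ S₂} → DB G S₁ → DB G S₂ → center G S₁ ≡ S₂ → center G S₂ ≡ S₁
    center-swap 0<n {S₁} {S₂} db₁ db₂ refl = ⊆-antisym C₂⊆S₁ S₁⊆C₂
      where
      module C₁ v = Equivalence (DB⇒∈center⇔antipode∉ S₁ 0<n db₁ v)
      module C₂ v = Equivalence (DB⇒∈center⇔antipode∉ S₂ 0<n db₂ v)

      C₂⊆S₁ : center G S₂ ⊆ S₁
      C₂⊆S₁ {v} v∈C₂ = decidable-stable (v ∈? S₁) λ v∉S₁ →
        C₂.to v v∈C₂ (C₁.from (a v) (subst (_∉ S₁) (≡.sym (antipode-involutive v)) v∉S₁))

      S₁⊆C₂ : S₁ ⊆ center G S₂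
      S₁⊆C₂ {v} v∈S₁ = C₂.from v λ av∈S₂ →
        C₁.to (a v) av∈S₂ (subst (_∈ S₁) (≡.sym (antipode-involutive v)) v∈S₁)

mainTheorem16 : ∀ {n : ℕ} (G : Graph n) → 0 < n → Connected G → SymmetricEven G →
    ((S : Subset n) → Nonempty S → (DB G S ⇔ DB G (center G S)))
    × ((S₁ S₂ : Subset n) → DB G S₁ → DB G S₂ → (center G S₁ ≡ S₂ ⇔ center G S₂ ≡ S₁))
mainTheorem16 G 0<n _ se =
  (λ S nonempty → mk⇔ (DB⇒center-DB S nonempty) (center-DB⇒DB S nonempty))
  , (λ S₁ S₂ db₁ db₂ → mk⇔ (center-swap 0<n db₁ db₂) (center-swap 0<n db₂ db₁))
  where open Antipodal G se
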